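{- There exists $c>0$ for which the following holds: for any integer $t\ge2$ there exists $n_t>0$ such that for all $n\ge n_t$ and all integers $j\in[1,m]$, where $m=\lfloor (t-1)n/2\rfloor$, $$\frac{\ell_j(t,n)}{\ell_{j-1}(t,n)}\ge 1+\frac{c}{t^2n}.$$
   Context: $[t]^n=\{0,1,\ldots,t-1\}^n$; $\ell_k(t,n)$ denotes the number of elements of $[t]^n$ whose coordinates sum to $k$. -}

module Defs where

open import Data.Nat using (ℕ; zero; suc; _+_)
open import Data.Fin using (Fin; toℕ)
open import Data.Fin.Properties using (all?)
open import Data.Vec using (Vec; []; _∷_)
open import Data.List using (List; []; _∷_; length; filter; map; concatMap; allFin)
open import Relation.Binary.PropositionalEquality using (_≡_)
import Data.Nat as ℕ

cube : (t n : ℕ) → List (Vec (Fin t) n)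
cube t zero = [] ∷ []
cube t (suc n) = concatMap (λ a → map (a ∷_) (cube t n)) (allFin t)

coordSum : ∀ {t n} → Vec (Fin t) n → ℕ
coordSum [] = 0
coordSum (a ∷ v) = toℕ a + coordSum v

ℓ : (k t n : ℕ) → ℕ
ℓ k t n = length (filter (λ v → coordSum v ℕ.≟ k) (cube t n))

{-# OPTIONS --safe #-}
module Submission where

-- Write L = layer t n for k ↦ ℓ_k(t,n) and f = layer t (n-1), so that L(k) = Σ_{a<t} f(k-a).
-- Three facts drive the argument: the symmetry L(k) = L(N-k) with N = (t-1)n; the mean identity
-- k·L(k) = n·Σ_{a<t} a·f(k-a) (a point of [t]^n with coordinate sum k has mean last coordinate
-- k/n); and the PF₂ property f(x-1)f(y+1) ≤ f(x)f(y) for x ≤ y, which survives summing t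
-- consecutive translates.  Fix J ≤ N/2, let K = N+1-J be the reflection of J-1, and
-- Δ = L(J) - L(J-1).  PF₂ applied to the pairs (J-a, K) and (J, K-a), weighted by a and combined
-- with the mean identity at J and K, gives f(J)L(J-1) ≤ N·D for
-- D = f(J)L(J-1) - f(J-t)L(J) = Δ·(L(J) - f(J)) ≤ Δ·L(J).  The mean identity at K and K-1 gives
-- (n-1)L(J) ≤ n·t·f(J).  Multiplying, (n-1)L(J-1) ≤ n·t·N·Δ, and n ≥ t turns this into
-- L(J-1) ≤ t²n·Δ: the constant is c = 1, with n_t = t.

open import Defs

module CubeLayers where

  open import Function using (_∘_)
  open import Data.Bool using (true; false)
  open import Data.Product using (_,_)
  open import Data.Sum using (inj₁; inj₂)
  open import Data.Nat as ℕ using (ℕ; zero; suc)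
  import Data.Nat.Properties as ℕ
  import Data.Nat.DivMod as ℕ
  import Data.Nat.Coprimality as Coprimality
  open import Data.Integer as ℤ using (ℤ; +_; -[1+_]; 0ℤ; 1ℤ; _+_; _*_; _-_; -_; _≤_; _<_; +≤+)
  import Data.Integer.Properties as ℤ
  open import Data.Integer.Tactic.RingSolver using (solve-∀)
  open import Data.Rational as ℚ using (mkℚ; 1ℚ)
  import Data.Rational.Properties as ℚ
  import Data.Rational.Unnormalised as ℚᵘ
  import Data.Rational.Unnormalised.Properties as ℚᵘ
  open import Data.Fin as Fin using (Fin; toℕ; opposite)
  import Data.Fin.Properties as Fin
  import Data.Fin.Permutation as Permutation
  open import Data.Vec using (Vec; _∷_)
  open import Data.Vec.Functional using (Vector; removeAt)
  open import Data.List using (List; []; _∷_; _++_; length; filter; map; concat; tabulate)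
  import Data.List.Properties as List
  open import Algebra.Properties.Semiring.Sum ℤ.+-*-semiring
  open import Relation.Nullary using (does)
  open import Relation.Unary using (Pred; Decidable)
  open import Relation.Binary.PropositionalEquality hiding (J)

  ≤-gap : ∀ {x y} d → 0ℤ ≤ d → x + d ≡ y → x ≤ y
  ≤-gap {x} d d≥0 refl = ℤ.i≤i+j x d ⦃ ℤ.nonNegative d≥0 ⦄

  *-nonNeg : ∀ {x y} → 0ℤ ≤ x → 0ℤ ≤ y → 0ℤ ≤ x * y
  *-nonNeg {x} {y} x≥0 y≥0 = subst (_≤ x * y) (ℤ.*-zeroʳ x) (ℤ.*-monoˡ-≤-nonNeg x ⦃ ℤ.nonNegative x≥0 ⦄ y≥0)

  ≤-cancelˡ : ∀ {c x y} → 1ℤ ≤ c → c * x ≤ c * y → x ≤ y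
  ≤-cancelˡ {+ suc c} {x} {y} (+≤+ (ℕ.s≤s _)) = ℤ.*-cancelˡ-≤-pos x y (+ suc c)

  nonNeg-cancelˡ : ∀ {c d} → 1ℤ ≤ c → 0ℤ ≤ c * d → 0ℤ ≤ d
  nonNeg-cancelˡ {c} {d} c≥1 0≤cd = ≤-cancelˡ c≥1 (subst (_≤ c * d) (sym (ℤ.*-zeroʳ c)) 0≤cd)

  +-∸ : ∀ {m n} → n ℕ.≤ m → + m - + n ≡ + (m ℕ.∸ n)
  +-∸ {m} {n} n≤m = trans (ℤ.m-n≡m⊖n m n) (ℤ.⊖-≥ n≤m)

  sum-mono-≤ : ∀ {n} {f g : Vector ℤ n} → (∀ i → f i ≤ g i) → sum f ≤ sum g
  sum-mono-≤ {zero}  f≤g = ℤ.≤-refl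
  sum-mono-≤ {suc n} f≤g = ℤ.+-mono-≤ (f≤g Fin.zero) (sum-mono-≤ (f≤g ∘ Fin.suc))

  sum-nonNeg : ∀ {n} {f : Vector ℤ n} → (∀ i → 0ℤ ≤ f i) → 0ℤ ≤ sum f
  sum-nonNeg {n} {f} f≥0 = subst (_≤ sum f) (sum-replicate-zero n) (sum-mono-≤ f≥0)

  term≤sum : ∀ {n} {f : Vector ℤ n} → (∀ i → 0ℤ ≤ f i) → ∀ i → f i ≤ sum f
  term≤sum {suc n} {f} f≥0 i =
    ≤-gap (sum (removeAt f i)) (sum-nonNeg (f≥0 ∘ Fin.punchIn i)) (sym (sum-remove f))

  sum-weighted-≤ : ∀ {n} c (w q : Vector ℤ n) → (∀ i → w i ≤ c) → (∀ i → 0ℤ ≤ q i) →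
                   ∑[ i < n ] (w i * q i) ≤ c * sum q
  sum-weighted-≤ {n} c w q w≤c q≥0 = begin
    ∑[ i < n ] (w i * q i)  ≤⟨ sum-mono-≤ (λ i → ℤ.*-monoʳ-≤-nonNeg (q i) ⦃ ℤ.nonNegative (q≥0 i) ⦄ (w≤c i)) ⟩
    ∑[ i < n ] (c * q i)    ≡⟨ *-distribˡ-sum c q ⟨
    c * sum q               ∎
    where open ℤ.≤-Reasoning

  ∑-linear : ∀ {n} x y (f g : Vector ℤ n) → ∑[ i < n ] (x * f i - y * g i) ≡ x * sum f - y * sum g
  ∑-linear {n} x y f g = begin
    ∑[ i < n ] (x * f i - y * g i)
      ≡⟨ sum-cong-≗ {n} (λ i → cong (_+_ (x * f i)) (ℤ.neg-distribˡ-* y (g i))) ⟩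
    ∑[ i < n ] (x * f i + - y * g i)
      ≡⟨ ∑-distrib-+ (λ i → x * f i) (λ i → - y * g i) ⟩
    ∑[ i < n ] (x * f i) + ∑[ i < n ] (- y * g i)
      ≡⟨ cong₂ _+_ (*-distribˡ-sum x f) (*-distribˡ-sum (- y) g) ⟨
    x * sum f + - y * sum g
      ≡⟨ cong (_+_ (x * sum f)) (ℤ.neg-distribˡ-* y (sum g)) ⟨
    x * sum f - y * sum g
      ∎
    where open ≡-Reasoning

  ∑-linear-nonNeg : ∀ {n} x y (f g : Vector ℤ n) → (∀ i → y * g i ≤ x * f i) → 0ℤ ≤ x * sum f - y * sum g
  ∑-linear-nonNeg {n} x y f g yg≤xf =
    subst (0ℤ ≤_) (∑-linear x y f g) (sum-nonNeg {n} (λ i → ℤ.i≤j⇒0≤j-i (yg≤xf i)))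

  sum-snoc : ∀ n (h : ℕ → ℤ) → ∑[ i < suc n ] h (toℕ i) ≡ ∑[ i < n ] h (toℕ i) + h n
  sum-snoc n h = begin
    ∑[ i < suc n ] h (toℕ i)
      ≡⟨ sum-init-last {n} (h ∘ toℕ) ⟩
    ∑[ i < n ] h (toℕ (Fin.inject₁ i)) + h (toℕ (Fin.fromℕ n))
      ≡⟨ cong₂ _+_ (sum-cong-≗ {n} (cong h ∘ Fin.toℕ-inject₁)) (cong h (Fin.toℕ-fromℕ n)) ⟩
    ∑[ i < n ] h (toℕ i) + h n
      ∎
    where open ≡-Reasoning

  sum-reflect : ∀ n (h h′ : ℕ → ℤ) → (∀ a b → a ℕ.+ b ≡ n → h a ≡ h′ b) →
                ∑[ i < suc n ] h (toℕ i) ≡ ∑[ i < suc n ] h′ (toℕ i)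
  sum-reflect n h h′ h≡h′ = begin
    ∑[ i < suc n ] h (toℕ i)
      ≡⟨ ∑-permute (h ∘ toℕ) (Permutation.reverse {suc n}) ⟩
    ∑[ i < suc n ] h (toℕ (opposite i))
      ≡⟨ sum-cong-≗ {suc n} (λ i → h≡h′ (toℕ (opposite i)) (toℕ i) (opposite+i≡n i)) ⟩
    ∑[ i < suc n ] h′ (toℕ i)
      ∎
    where
    open ≡-Reasoning
    opposite+i≡n : ∀ i → toℕ (opposite i) ℕ.+ toℕ i ≡ n
    opposite+i≡n i = trans (cong (ℕ._+ toℕ i) (Fin.opposite-prop i)) (ℕ.m∸n+n≡m (Fin.toℕ≤pred[n] i))

  window : ℕ → (ℤ → ℤ) → ℤ → ℤ
  window t g k = ∑[ i < t ] g (k - + toℕ i)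

  moment : ℕ → (ℤ → ℤ) → ℤ → ℤ
  moment t g k = ∑[ i < t ] (+ toℕ i * g (k - + toℕ i))

  private
    sub-suc : ∀ k a → k - (1ℤ + a) ≡ k - 1ℤ - a
    sub-suc = solve-∀

  window-cong : ∀ t {g h} → (∀ x → g x ≡ h x) → ∀ k → window t g k ≡ window t h k
  window-cong t g≗h k = sum-cong-≗ {t} (λ i → g≗h (k - + toℕ i))

  window-nonNeg : ∀ t {g} → (∀ x → 0ℤ ≤ g x) → ∀ k → 0ℤ ≤ window t g k
  window-nonNeg t g≥0 k = sum-nonNeg {t} (λ i → g≥0 (k - + toℕ i))

  window-≥-term : ∀ t {g} → (∀ x → 0ℤ ≤ g x) → ∀ k {a} → a ℕ.< t → g (k - + a) ≤ window t g k
  window-≥-term t {g} g≥0 k a<t = subst (λ b → g (k - + b) ≤ window t g k) (Fin.toℕ-fromℕ< a<t)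
    (term≤sum (λ i → g≥0 (k - + toℕ i)) (Fin.fromℕ< a<t))

  window-suc : ∀ t g k → window (suc t) g k ≡ g k + window t g (k - 1ℤ)
  window-suc t g k = cong₂ _+_ (cong g (ℤ.+-identityʳ k)) (sum-cong-≗ {t} (λ i → cong g (sub-suc k (+ toℕ i))))

  window-difference : ∀ t g k → window t g k + g (k - + t) ≡ g k + window t g (k - 1ℤ)
  window-difference t g k = trans (sym (sum-snoc t (λ a → g (k - + a)))) (window-suc t g k)

  moment-difference : ∀ t g k → moment t g k + + t * g (k - + t) ≡ moment t g (k - 1ℤ) + window t g (k - 1ℤ)
  moment-difference t g k = begin
    moment t g k + + t * g (k - + t)
      ≡⟨ sum-snoc t (λ a → + a * g (k - + a)) ⟨
    moment (suc t) g k
      ≡⟨ ℤ.+-identityˡ _ ⟩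
    ∑[ i < t ] (+ suc (toℕ i) * g (k - + suc (toℕ i)))
      ≡⟨ sum-cong-≗ {t} (λ i → shift (+ toℕ i)) ⟩
    ∑[ i < t ] (+ toℕ i * g (k - 1ℤ - + toℕ i) + g (k - 1ℤ - + toℕ i))
      ≡⟨ ∑-distrib-+ {t} (λ i → + toℕ i * g (k - 1ℤ - + toℕ i)) (λ i → g (k - 1ℤ - + toℕ i)) ⟩
    moment t g (k - 1ℤ) + window t g (k - 1ℤ)
      ∎
    where
    open ≡-Reasoning
    distrib : ∀ a x → (1ℤ + a) * x ≡ a * x + x
    distrib = solve-∀
    shift : ∀ a → (1ℤ + a) * g (k - (1ℤ + a)) ≡ a * g (k - 1ℤ - a) + g (k - 1ℤ - a)
    shift a = trans (cong (λ x → (1ℤ + a) * g x) (sub-suc k a)) (distrib a _)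

  window-*ˡ : ∀ t c g k → window t (λ x → c * g x) k ≡ c * window t g k
  window-*ˡ t c g k = sym (*-distribˡ-sum {t} c (λ i → g (k - + toℕ i)))

  *-window : ∀ t g k → k * window t g k ≡ window t (λ x → x * g x) k + moment t g k
  *-window t g k = begin
    k * window t g k
      ≡⟨ *-distribˡ-sum {t} k (λ i → g (k - a i)) ⟩
    ∑[ i < t ] (k * g (k - a i))
      ≡⟨ sum-cong-≗ {t} (λ i → split k (a i) _) ⟩
    ∑[ i < t ] ((k - a i) * g (k - a i) + a i * g (k - a i))
      ≡⟨ ∑-distrib-+ {t} (λ i → (k - a i) * g (k - a i)) (λ i → a i * g (k - a i)) ⟩
    window t (λ x → x * g x) k + moment t g k
      ∎
    where
    open ≡-Reasoning
    a : Fin t → ℤ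
    a i = + toℕ i
    split : ∀ k a x → k * x ≡ (k - a) * x + a * x
    split = solve-∀

  window-moment : ∀ t g k → window t (moment t g) k ≡ moment t (window t g) k
  window-moment t g k = begin
    ∑[ i < t ] ∑[ j < t ] (a j * g (k - a i - a j))
      ≡⟨ ∑-comm {t} {t} (λ i j → a j * g (k - a i - a j)) ⟩
    ∑[ j < t ] ∑[ i < t ] (a j * g (k - a i - a j))
      ≡⟨ sum-cong-≗ {t} (λ j → sum-cong-≗ {t} (λ i → cong (λ x → a j * g x) (swap k (a i) (a j)))) ⟩
    ∑[ j < t ] ∑[ i < t ] (a j * g (k - a j - a i))
      ≡⟨ sum-cong-≗ {t} (λ j → *-distribˡ-sum {t} (a j) (λ i → g (k - a j - a i))) ⟨
    ∑[ j < t ] (a j * window t g (k - a j))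
      ∎
    where
    open ≡-Reasoning
    a : Fin t → ℤ
    a i = + toℕ i
    swap : ∀ k x y → k - x - y ≡ k - y - x
    swap = solve-∀

  δ₀ : ℤ → ℤ
  δ₀ (+ zero)  = 1ℤ
  δ₀ (+ suc _) = 0ℤ
  δ₀ -[1+ _ ]  = 0ℤ

  δ₀-nonNeg : ∀ x → 0ℤ ≤ δ₀ x
  δ₀-nonNeg (+ zero)  = +≤+ ℕ.z≤n
  δ₀-nonNeg (+ suc _) = +≤+ ℕ.z≤n
  δ₀-nonNeg -[1+ _ ]  = +≤+ ℕ.z≤n

  *-δ₀ : ∀ x → x * δ₀ x ≡ 0ℤ
  *-δ₀ (+ zero)     = refl
  *-δ₀ x@(+ suc _)  = ℤ.*-zeroʳ x
  *-δ₀ x@(-[1+ _ ]) = ℤ.*-zeroʳ x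

  δ₀-neg : ∀ x → δ₀ (- x) ≡ δ₀ x
  δ₀-neg (+ zero)  = refl
  δ₀-neg (+ suc _) = refl
  δ₀-neg -[1+ _ ]  = refl

  layer : ℕ → ℕ → ℤ → ℤ
  layer t zero    = δ₀
  layer t (suc n) = window t (layer t n)

  layer-nonNeg : ∀ t n x → 0ℤ ≤ layer t n x
  layer-nonNeg t zero    = δ₀-nonNeg
  layer-nonNeg t (suc n) = window-nonNeg t (layer-nonNeg t n)

  layer-mean : ∀ t n k → k * layer t (suc n) k ≡ + suc n * moment t (layer t n) k
  layer-mean t zero k = begin
    k * window t δ₀ k                            ≡⟨ *-window t δ₀ k ⟩
    window t (λ x → x * δ₀ x) k + moment t δ₀ k  ≡⟨ cong (_+ moment t δ₀ k) no-mass ⟩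
    0ℤ + moment t δ₀ k                           ≡⟨ ℤ.+-identityˡ _ ⟩
    moment t δ₀ k                                ≡⟨ ℤ.*-identityˡ _ ⟨
    1ℤ * moment t δ₀ k                           ∎
    where
    open ≡-Reasoning
    no-mass : window t (λ x → x * δ₀ x) k ≡ 0ℤ
    no-mass = trans (window-cong t *-δ₀ k) (sum-replicate-zero t)
  layer-mean t (suc n) k = begin
    k * window t L k                              ≡⟨ *-window t L k ⟩
    window t (λ x → x * L x) k + M                ≡⟨ cong (_+ M) (window-cong t (layer-mean t n) k) ⟩
    window t (λ x → + suc n * moment t f x) k + M ≡⟨ cong (_+ M) (window-*ˡ t (+ suc n) (moment t f) k) ⟩
    + suc n * window t (moment t f) k + M         ≡⟨ cong (λ y → + suc n * y + M) (window-moment t f k) ⟩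
    + suc n * M + M                               ≡⟨ *-suc (+ suc n) M ⟩
    + suc (suc n) * M                             ∎
    where
    open ≡-Reasoning
    f = layer t n
    L = layer t (suc n)
    M = moment t L k
    *-suc : ∀ a m → a * m + m ≡ (1ℤ + a) * m
    *-suc = solve-∀

  layer-reflect : ∀ T n x y → x + y ≡ + (T ℕ.* n) → layer (suc T) n x ≡ layer (suc T) n y
  layer-reflect T zero x y x+y≡T*0 = trans (sym (δ₀-neg x)) (cong δ₀ -x≡y)
    where
    cancel : ∀ x y → - x + (x + y) ≡ y
    cancel = solve-∀
    -x≡y : - x ≡ y
    -x≡y = trans (sym (ℤ.+-identityʳ (- x)))
                 (trans (cong (_+_ (- x)) (sym (trans x+y≡T*0 (cong +_ (ℕ.*-zeroʳ T))))) (cancel x y))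
  layer-reflect T (suc n) x y x+y≡N =
    sum-reflect T (λ a → layer (suc T) n (x - + a)) (λ b → layer (suc T) n (y - + b))
      (λ a b a+b≡T → layer-reflect T n (x - + a) (y - + b) (pair a b a+b≡T))
    where
    regroup : ∀ x y a b → (x - a) + (y - b) ≡ (x + y) - (a + b)
    regroup = solve-∀
    cancel : ∀ u v → (u + v) - u ≡ v
    cancel = solve-∀
    pair : ∀ a b → a ℕ.+ b ≡ T → (x - + a) + (y - + b) ≡ + (T ℕ.* n)
    pair a b a+b≡T = begin
      (x - + a) + (y - + b)    ≡⟨ regroup x y (+ a) (+ b) ⟩
      (x + y) - + (a ℕ.+ b)    ≡⟨ cong₂ (λ u v → u - + v) x+y≡N a+b≡T ⟩
      + (T ℕ.* suc n) - + T    ≡⟨ cong (λ u → + u - + T) (ℕ.*-suc T n) ⟩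
      + T + + (T ℕ.* n) - + T  ≡⟨ cancel (+ T) (+ (T ℕ.* n)) ⟩
      + (T ℕ.* n)              ∎
      where open ≡-Reasoning

  layer-positive : ∀ T n k → k ℕ.≤ T ℕ.* n → 1ℤ ≤ layer (suc T) n (+ k)
  layer-positive T zero k k≤T*0 rewrite ℕ.*-zeroʳ T | ℕ.n≤0⇒n≡0 k≤T*0 = ℤ.≤-refl
  layer-positive T (suc n) k k≤N = begin
    1ℤ                                   ≤⟨ layer-positive T n (k ℕ.∸ T) k∸T≤Tn ⟩
    layer (suc T) n (+ (k ℕ.∸ T))        ≡⟨ cong (layer (suc T) n) k-[k⊓T]≡k∸T ⟨
    layer (suc T) n (+ k - + (k ℕ.⊓ T))  ≤⟨ window-≥-term (suc T) (layer-nonNeg (suc T) n) (+ k) k⊓T<t ⟩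
    layer (suc T) (suc n) (+ k)          ∎
    where
    open ℤ.≤-Reasoning
    k⊓T<t : k ℕ.⊓ T ℕ.< suc T
    k⊓T<t = ℕ.s≤s (ℕ.m⊓n≤n k T)
    k∸T≤Tn : k ℕ.∸ T ℕ.≤ T ℕ.* n
    k∸T≤Tn = ℕ.m≤n+o⇒m∸n≤o k T (subst (k ℕ.≤_) (ℕ.*-suc T n) k≤N)
    k-[k⊓T]≡k∸T : + k - + (k ℕ.⊓ T) ≡ + (k ℕ.∸ T)
    k-[k⊓T]≡k∸T = trans (+-∸ (ℕ.m⊓n≤m k T))
      (cong +_ (trans (ℕ.∸-distribˡ-⊓-⊔ k k T) (cong (ℕ._⊔ (k ℕ.∸ T)) (ℕ.n∸n≡0 k))))

  length-filter-map : ∀ {a p} {A B : Set a} {P : Pred B p} (P? : Decidable P) (f : A → B) xs →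
                      length (filter P? (map f xs)) ≡ length (filter (P? ∘ f) xs)
  length-filter-map P? f []       = refl
  length-filter-map P? f (x ∷ xs) with does (P? (f x))
  ... | true  = cong suc (length-filter-map P? f xs)
  ... | false = length-filter-map P? f xs

  countSum : ∀ {t n} → ℤ → List (Vec (Fin t) n) → ℕ
  countSum x = length ∘ filter (λ v → + coordSum v ℤ.≟ x)

  countSum-++ : ∀ {t n} x (us vs : List (Vec (Fin t) n)) → countSum x (us ++ vs) ≡ countSum x us ℕ.+ countSum x vs
  countSum-++ x us vs = trans (cong length (List.filter-++ (λ v → + coordSum v ℤ.≟ x) us vs))
                              (List.length-++ (filter (λ v → + coordSum v ℤ.≟ x) us))

  countSum-concat : ∀ {t n m} x (h : Fin m → List (Vec (Fin t) n)) →
                    + countSum x (concat (tabulate h)) ≡ ∑[ i < m ] (+ countSum x (h i))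
  countSum-concat {m = zero}  x h = refl
  countSum-concat {m = suc m} x h = trans (cong +_ (countSum-++ x (h Fin.zero) _))
    (cong (_+_ (+ countSum x (h Fin.zero))) (countSum-concat x (h ∘ Fin.suc)))

  countSum-∷ : ∀ {t n} x (a : Fin t) (vs : List (Vec (Fin t) n)) →
               countSum x (map (a ∷_) vs) ≡ countSum (x - + toℕ a) vs
  countSum-∷ x a vs = trans (length-filter-map (λ v → + coordSum v ℤ.≟ x) (a ∷_) vs)
    (cong length (List.filter-≐ _ _ (shift , unshift) vs))
    where
    cancelʳ : ∀ u s → s ≡ (u + s) - u
    cancelʳ = solve-∀
    cancelˡ : ∀ u s → u + (s - u) ≡ s
    cancelˡ = solve-∀
    shift : ∀ {s} → + toℕ a + s ≡ x → s ≡ x - + toℕ a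
    shift {s} eq = trans (cancelʳ (+ toℕ a) s) (cong (_- + toℕ a) eq)
    unshift : ∀ {s} → s ≡ x - + toℕ a → + toℕ a + s ≡ x
    unshift {s} eq = trans (cong (_+_ (+ toℕ a)) eq) (cancelˡ (+ toℕ a) x)

  layer≡countSum : ∀ t n x → layer t n x ≡ + countSum x (cube t n)
  layer≡countSum t zero (+ zero)  = refl
  layer≡countSum t zero (+ suc _) = refl
  layer≡countSum t zero -[1+ _ ]  = refl
  layer≡countSum t (suc n) x = begin
    ∑[ i < t ] layer t n (x - + toℕ i)
      ≡⟨ sum-cong-≗ {t} (λ i → layer≡countSum t n (x - + toℕ i)) ⟩
    ∑[ i < t ] (+ countSum (x - + toℕ i) (cube t n))
      ≡⟨ sum-cong-≗ {t} (λ i → cong +_ (countSum-∷ x i (cube t n))) ⟨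
    ∑[ i < t ] (+ countSum x (map (i ∷_) (cube t n)))
      ≡⟨ countSum-concat x (λ i → map (i ∷_) (cube t n)) ⟨
    + countSum x (concat (tabulate (λ i → map (i ∷_) (cube t n))))
      ≡⟨ cong (λ vs → + countSum x (concat vs)) (List.map-tabulate (λ i → i) (λ a → map (a ∷_) (cube t n))) ⟨
    + countSum x (cube t (suc n))
      ∎
    where open ≡-Reasoning

  ℓ≡layer : ∀ k t n → + ℓ k t n ≡ layer t n (+ k)
  ℓ≡layer k t n = sym (trans (layer≡countSum t n (+ k))
    (cong (+_ ∘ length) (List.filter-≐ _ _ (ℤ.+-injective , cong (λ m → + m)) (cube t n))))

  -- For nonnegative g this is the Pólya frequency condition of order 2, i.e. log-concavity
  -- without internal zeros.
  PF₂ : (ℤ → ℤ) → Set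
  PF₂ g = ∀ {x y} → x ≤ y → g (x - 1ℤ) * g (y + 1ℤ) ≤ g x * g y

  PF₂-spread : ∀ g → PF₂ g → ∀ d {x y} → x ≤ y → g (x - + d) * g (y + + d) ≤ g x * g y
  PF₂-spread g pf zero {x} {y} x≤y =
    ℤ.≤-reflexive (cong₂ (λ u v → g u * g v) (ℤ.+-identityʳ x) (ℤ.+-identityʳ y))
  PF₂-spread g pf (suc d) {x} {y} x≤y = begin
    g (x - + suc d) * g (y + + suc d)    ≡⟨ cong₂ (λ u v → g u * g v) (sub-suc′ x (+ d)) (add-suc y (+ d)) ⟩
    g (x - + d - 1ℤ) * g (y + + d + 1ℤ)  ≤⟨ pf x-d≤y+d ⟩
    g (x - + d) * g (y + + d)            ≤⟨ PF₂-spread g pf d x≤y ⟩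
    g x * g y                            ∎
    where
    open ℤ.≤-Reasoning
    sub-suc′ : ∀ x d → x - (1ℤ + d) ≡ x - d - 1ℤ
    sub-suc′ = solve-∀
    add-suc : ∀ y d → y + (1ℤ + d) ≡ y + d + 1ℤ
    add-suc = solve-∀
    x-d≤y+d : x - + d ≤ y + + d
    x-d≤y+d = ℤ.≤-trans (ℤ.i-j≤i x (+ d)) (ℤ.≤-trans x≤y (ℤ.i≤i+j y (+ d)))

  PF₂-exchange-≤ : ∀ g → PF₂ g → ∀ {a b c e} → a ≤ b → c ≤ a → a + b ≡ c + e → g c * g e ≤ g a * g b
  PF₂-exchange-≤ g pf {a} {b} {c} {e} a≤b c≤a a+b≡c+e = begin
    g c * g e                  ≡⟨ cong₂ (λ u v → g u * g v) a-d≡c b+d≡e ⟨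
    g (a - + d) * g (b + + d)  ≤⟨ PF₂-spread g pf d a≤b ⟩
    g a * g b                  ∎
    where
    open ℤ.≤-Reasoning
    d = ℤ.∣ a - c ∣
    +d≡a-c : + d ≡ a - c
    +d≡a-c = ℤ.0≤i⇒+∣i∣≡i (ℤ.i≤j⇒0≤j-i c≤a)
    cancel : ∀ a c → a - (a - c) ≡ c
    cancel = solve-∀
    regroup : ∀ a b c → b + (a - c) ≡ (a + b) - c
    regroup = solve-∀
    cancelˡ : ∀ c e → c + e - c ≡ e
    cancelˡ = solve-∀
    a-d≡c : a - + d ≡ c
    a-d≡c = trans (cong (_-_ a) +d≡a-c) (cancel a c)
    b+d≡e : b + + d ≡ e
    b+d≡e = trans (cong (_+_ b) +d≡a-c) (trans (regroup a b c) (trans (cong (_- c) a+b≡c+e) (cancelˡ c e)))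

  PF₂-exchange : ∀ g → PF₂ g → ∀ {a b c e} → c ≤ a → c ≤ b → a + b ≡ c + e → g c * g e ≤ g a * g b
  PF₂-exchange g pf {a} {b} c≤a c≤b a+b≡c+e with ℤ.≤-total a b
  ... | inj₁ a≤b = PF₂-exchange-≤ g pf a≤b c≤a a+b≡c+e
  ... | inj₂ b≤a = subst (_ ≤_) (ℤ.*-comm (g b) (g a))
                     (PF₂-exchange-≤ g pf b≤a c≤b (trans (ℤ.+-comm b a) a+b≡c+e))

  δ₀-*-< : ∀ {u v} → u < v → δ₀ u * δ₀ v ≡ 0ℤ
  δ₀-*-< {+ zero}  {+ suc _} _          = refl
  δ₀-*-< {+ zero}  {+ zero}  (ℤ.+<+ ())
  δ₀-*-< {+ suc _}           _          = refl
  δ₀-*-< { -[1+ _ ]}         _          = refl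

  δ₀-PF₂ : PF₂ δ₀
  δ₀-PF₂ {x} {y} x≤y = begin
    δ₀ (x - 1ℤ) * δ₀ (y + 1ℤ)  ≡⟨ δ₀-*-< (ℤ.i≤pred[j]⇒i<j x-1≤y) ⟩
    0ℤ                         ≤⟨ *-nonNeg (δ₀-nonNeg x) (δ₀-nonNeg y) ⟩
    δ₀ x * δ₀ y                ∎
    where
    open ℤ.≤-Reasoning
    shift : ∀ y o → y ≡ - o + (y + o)
    shift = solve-∀
    x-1≤y : x - 1ℤ ≤ ℤ.pred (y + 1ℤ)
    x-1≤y = subst (x - 1ℤ ≤_) (shift y 1ℤ) (ℤ.≤-trans (ℤ.i-j≤i x 1ℤ) x≤y)

  sum-shift-exchange : ∀ t (a b : ℕ → ℤ) → (∀ {u v} → u ℕ.≤ v → v ℕ.≤ t → a v * b u ≤ a u * b v) →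
                       (∑[ i < t ] a (suc (toℕ i))) * (∑[ i < t ] b (toℕ i)) ≤
                       (∑[ i < t ] a (toℕ i)) * (∑[ i < t ] b (suc (toℕ i)))
  sum-shift-exchange zero    a b exchange = ℤ.≤-refl
  sum-shift-exchange (suc T) a b exchange = begin
    (∑[ i < t ] a (suc (toℕ i))) * (b 0 + SB)  ≡⟨ cong (_* (b 0 + SB)) (sum-snoc T (a ∘ suc)) ⟩
    (SA + a t) * (b 0 + SB)                    ≤⟨ ≤-gap (P₁ + P₂ + P₃) (ℤ.+-mono-≤ (ℤ.+-mono-≤ P₁≥0 P₂≥0) P₃≥0)
                                                        (regroup (a 0) (a t) (b 0) (b t) SA SB) ⟩
    (a 0 + SA) * (SB + b t)                    ≡⟨ cong ((a 0 + SA) *_) (sum-snoc T (b ∘ suc)) ⟨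
    (a 0 + SA) * (∑[ i < t ] b (suc (toℕ i)))  ∎
    where
    open ℤ.≤-Reasoning
    t = suc T
    SA = ∑[ i < T ] a (suc (toℕ i))
    SB = ∑[ i < T ] b (suc (toℕ i))
    P₁ = a 0 * SB - b 0 * SA
    P₂ = b t * SA - a t * SB
    P₃ = a 0 * b t - a t * b 0
    1+i≤t : ∀ (i : Fin T) → suc (toℕ i) ℕ.≤ t
    1+i≤t i = ℕ.<⇒≤ (ℕ.s≤s (Fin.toℕ<n i))
    P₁≥0 : 0ℤ ≤ P₁
    P₁≥0 = ∑-linear-nonNeg {T} (a 0) (b 0) (b ∘ suc ∘ toℕ) (a ∘ suc ∘ toℕ) (λ i →
      subst (_≤ a 0 * b (suc (toℕ i))) (ℤ.*-comm (a (suc (toℕ i))) (b 0)) (exchange ℕ.z≤n (1+i≤t i)))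
    P₂≥0 : 0ℤ ≤ P₂
    P₂≥0 = ∑-linear-nonNeg {T} (b t) (a t) (a ∘ suc ∘ toℕ) (b ∘ suc ∘ toℕ) (λ i →
      subst (a t * b (suc (toℕ i)) ≤_) (ℤ.*-comm (a (suc (toℕ i))) (b t)) (exchange (1+i≤t i) ℕ.≤-refl))
    P₃≥0 : 0ℤ ≤ P₃
    P₃≥0 = ℤ.i≤j⇒0≤j-i (exchange ℕ.z≤n ℕ.≤-refl)
    regroup : ∀ a₀ aₜ b₀ bₜ sa sb →
              (sa + aₜ) * (b₀ + sb) + ((a₀ * sb - b₀ * sa) + (bₜ * sa - aₜ * sb) + (a₀ * bₜ - aₜ * b₀)) ≡
              (a₀ + sa) * (sb + bₜ)
    regroup = solve-∀

  window-PF₂ : ∀ t g → PF₂ g → PF₂ (window t g)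
  window-PF₂ t g pf {x} {y} x≤y = subst₂ _≤_ (cong (_* window t g (y + 1ℤ)) shiftˣ) (cong (window t g x *_) shiftʸ)
                                            (sum-shift-exchange t a b exchange)
    where
    a b : ℕ → ℤ
    a u = g (x - + u)
    b v = g (y + 1ℤ - + v)
    unshift : ∀ y v → y + 1ℤ - (1ℤ + v) ≡ y - v
    unshift = solve-∀
    shiftˣ : ∑[ i < t ] a (suc (toℕ i)) ≡ window t g (x - 1ℤ)
    shiftˣ = sum-cong-≗ {t} (λ i → cong g (sub-suc x (+ toℕ i)))
    shiftʸ : ∑[ i < t ] b (suc (toℕ i)) ≡ window t g y
    shiftʸ = sum-cong-≗ {t} (λ i → cong g (unshift y (+ toℕ i)))
    swap : ∀ x y u v → (x - u) + (y + 1ℤ - v) ≡ (x - v) + (y + 1ℤ - u)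
    swap = solve-∀
    exchange : ∀ {u v} → u ℕ.≤ v → v ℕ.≤ t → a v * b u ≤ a u * b v
    exchange {u} {v} u≤v _ = PF₂-exchange g pf
      (ℤ.+-monoʳ-≤ x (ℤ.neg-mono-≤ (+≤+ u≤v)))
      (ℤ.+-monoˡ-≤ (- + v) (ℤ.≤-trans x≤y (ℤ.i≤i+j y 1ℤ)))
      (swap x y (+ u) (+ v))

  layer-PF₂ : ∀ t n → PF₂ (layer t n)
  layer-PF₂ t zero    = δ₀-PF₂
  layer-PF₂ t (suc n) = window-PF₂ t (layer t n) (layer-PF₂ t n)

  PF₂-moment-window : ∀ T g → PF₂ g → ∀ {J K} → J ≤ K →
                      g J * moment (suc T) g K - g K * moment (suc T) g J ≤
                      + T * (g J * window (suc T) g K - g K * window (suc T) g J)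
  PF₂-moment-window T g pf {J} {K} J≤K = begin
    g J * moment t g K - g K * moment t g J
      ≡⟨ ∑-linear (g J) (g K) (λ i → a i * g (K - a i)) (λ i → a i * g (J - a i)) ⟨
    ∑[ i < t ] (g J * (a i * g (K - a i)) - g K * (a i * g (J - a i)))
      ≡⟨ sum-cong-≗ {t} (λ i → factor (a i) (g J) (g (K - a i)) (g K) (g (J - a i))) ⟩
    ∑[ i < t ] (a i * q i)
      ≤⟨ sum-weighted-≤ (+ T) a q (λ i → +≤+ (ℕ.s≤s⁻¹ (Fin.toℕ<n i))) q≥0 ⟩
    + T * sum q
      ≡⟨ cong (+ T *_) (∑-linear (g J) (g K) (λ i → g (K - a i)) (λ i → g (J - a i))) ⟩
    + T * (g J * window t g K - g K * window t g J)
      ∎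
    where
    open ℤ.≤-Reasoning
    t = suc T
    a q : Fin t → ℤ
    a i = + toℕ i
    q i = g J * g (K - a i) - g K * g (J - a i)
    factor : ∀ w x y u v → x * (w * y) - u * (w * v) ≡ w * (x * y - u * v)
    factor = solve-∀
    swap : ∀ J K a → J + (K - a) ≡ (J - a) + K
    swap = solve-∀
    q≥0 : ∀ i → 0ℤ ≤ q i
    q≥0 i = ℤ.i≤j⇒0≤j-i (subst (_≤ g J * g (K - a i)) (ℤ.*-comm (g (J - a i)) (g K))
      (PF₂-exchange g pf (ℤ.i-j≤i J (a i)) (ℤ.+-monoˡ-≤ (- a i) J≤K) (swap J K (a i))))

  cross-bound : ∀ N J K X Y → 0ℤ ≤ J → 1ℤ ≤ K - J → 1ℤ ≤ N - J → 0ℤ ≤ X →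
                K * X - J * Y ≤ N * (X - Y) → X ≤ N * (X - Y)
  cross-bound N J K X Y J≥0 K-J≥1 N-J≥1 X≥0 cross =
    ℤ.≤-trans X≤[N-J]D (≤-gap (J * D) (*-nonNeg J≥0 D≥0) (shrink N J D))
    where
    D = X - Y
    grow : ∀ K J X → X + (K - J - 1ℤ) * X ≡ (K - J) * X
    grow = solve-∀
    shiftˡ : ∀ K J X Y → (K - J) * X ≡ K * X - J * Y - J * (X - Y)
    shiftˡ = solve-∀
    shiftʳ : ∀ N J D → N * D - J * D ≡ (N - J) * D
    shiftʳ = solve-∀
    shrink : ∀ N J D → (N - J) * D + J * D ≡ N * D
    shrink = solve-∀
    X≤[N-J]D : X ≤ (N - J) * D
    X≤[N-J]D = begin
      X                      ≤⟨ ≤-gap ((K - J - 1ℤ) * X) (*-nonNeg (ℤ.i≤j⇒0≤j-i K-J≥1) X≥0) (grow K J X) ⟩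
      (K - J) * X            ≡⟨ shiftˡ K J X Y ⟩
      K * X - J * Y - J * D  ≤⟨ ℤ.+-monoˡ-≤ (- (J * D)) cross ⟩
      N * D - J * D          ≡⟨ shiftʳ N J D ⟩
      (N - J) * D            ∎
      where open ℤ.≤-Reasoning
    D≥0 : 0ℤ ≤ D
    D≥0 = nonNeg-cancelˡ N-J≥1 (ℤ.≤-trans X≥0 X≤[N-J]D)

  difference-factor : ∀ l l′ φ ψ → l + ψ ≡ φ + l′ → φ * l′ - ψ * l ≡ (l - l′) * (l - φ)
  difference-factor l l′ φ ψ balance = begin
    φ * l′ - ψ * l             ≡⟨ cong (λ z → φ * l′ - z * l) ψ≡ ⟩
    φ * l′ - (φ + l′ - l) * l  ≡⟨ factor l l′ φ ⟩
    (l - l′) * (l - φ)         ∎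
    where
    open ≡-Reasoning
    isolate : ∀ l ψ → ψ ≡ l + ψ - l
    isolate = solve-∀
    ψ≡ : ψ ≡ φ + l′ - l
    ψ≡ = trans (isolate l ψ) (cong (_- l) balance)
    factor : ∀ l l′ φ → φ * l′ - (φ + l′ - l) * l ≡ (l - l′) * (l - φ)
    factor = solve-∀

  mean-balance : ∀ n t K a b φ μ μ′ → K * a ≡ n * μ → (K - 1ℤ) * b ≡ n * μ′ → μ + t * φ ≡ μ′ + b →
                 n * t * φ ≡ (n - 1ℤ) * b + K * (b - a)
  mean-balance n t K a b φ μ μ′ meanᴷ meanᴷ⁻¹ step = begin
    n * t * φ                     ≡⟨ expand n t φ μ ⟩
    n * (μ + t * φ) - n * μ       ≡⟨ cong (λ z → n * z - n * μ) step ⟩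
    n * (μ′ + b) - n * μ          ≡⟨ distrib n μ′ b μ ⟩
    n * μ′ + n * b - n * μ        ≡⟨ cong₂ (λ u v → u + n * b - v) meanᴷ⁻¹ meanᴷ ⟨
    (K - 1ℤ) * b + n * b - K * a  ≡⟨ collect n K a b ⟩
    (n - 1ℤ) * b + K * (b - a)    ∎
    where
    open ≡-Reasoning
    expand : ∀ n t φ μ → n * t * φ ≡ n * (μ + t * φ) - n * μ
    expand = solve-∀
    distrib : ∀ n μ′ b μ → n * (μ′ + b) - n * μ ≡ n * μ′ + n * b - n * μ
    distrib = solve-∀
    collect : ∀ n K a b → (K - 1ℤ) * b + n * b - K * a ≡ (n - 1ℤ) * b + K * (b - a)
    collect = solve-∀

  ratio-bound : ∀ a b φ N n t → 0ℤ ≤ a → 1ℤ ≤ b → 1ℤ ≤ N → 0ℤ ≤ n → 0ℤ ≤ t → N ≤ t * (n - 1ℤ) →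
                φ * a ≤ N * ((b - a) * b) → (n - 1ℤ) * b ≤ n * t * φ →
                a * (t * t * n + 1ℤ) ≤ b * (t * t * n)
  ratio-bound a b φ N n t a≥0 b≥1 N≥1 n≥0 t≥0 N≤t[n-1] φa≤NΔb [n-1]b≤ntφ =
    ≤-gap (P * Δ - a) (ℤ.i≤j⇒0≤j-i a≤PΔ) (finish a b P)
    where
    open ℤ.≤-Reasoning
    P = t * t * n
    Δ = b - a
    rotate₁ : ∀ b n a → b * ((n - 1ℤ) * a) ≡ (n - 1ℤ) * b * a
    rotate₁ = solve-∀
    rotate₂ : ∀ n t N d b → n * t * (N * (d * b)) ≡ b * (n * t * N * d)
    rotate₂ = solve-∀
    rotate₃ : ∀ t n N d → t * (n * t * N * d) ≡ N * (t * t * n * d)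
    rotate₃ = solve-∀
    finish : ∀ a b P → a * (P + 1ℤ) + (P * (b - a) - a) ≡ b * P
    finish = solve-∀
    [n-1]a≤ntNΔ : (n - 1ℤ) * a ≤ n * t * N * Δ
    [n-1]a≤ntNΔ = ≤-cancelˡ b≥1 (begin
      b * ((n - 1ℤ) * a)     ≡⟨ rotate₁ b n a ⟩
      (n - 1ℤ) * b * a       ≤⟨ ℤ.*-monoʳ-≤-nonNeg a ⦃ ℤ.nonNegative a≥0 ⦄ [n-1]b≤ntφ ⟩
      n * t * φ * a          ≡⟨ ℤ.*-assoc (n * t) φ a ⟩
      n * t * (φ * a)        ≤⟨ ℤ.*-monoˡ-≤-nonNeg (n * t) ⦃ ℤ.nonNegative (*-nonNeg n≥0 t≥0) ⦄ φa≤NΔb ⟩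
      n * t * (N * (Δ * b))  ≡⟨ rotate₂ n t N Δ b ⟩
      b * (n * t * N * Δ)    ∎)
    a≤PΔ : a ≤ P * Δ
    a≤PΔ = ≤-cancelˡ N≥1 (begin
      N * a                  ≤⟨ ℤ.*-monoʳ-≤-nonNeg a ⦃ ℤ.nonNegative a≥0 ⦄ N≤t[n-1] ⟩
      t * (n - 1ℤ) * a       ≡⟨ ℤ.*-assoc t (n - 1ℤ) a ⟩
      t * ((n - 1ℤ) * a)     ≤⟨ ℤ.*-monoˡ-≤-nonNeg t ⦃ ℤ.nonNegative t≥0 ⦄ [n-1]a≤ntNΔ ⟩
      t * (n * t * N * Δ)    ≡⟨ rotate₃ t n N Δ ⟩
      N * (t * t * n * Δ)    ∎)

  module RatioBound (T m j : ℕ) (T≥1 : 1 ℕ.≤ T) (t≤n : suc T ℕ.≤ suc m) (j≥1 : 1 ℕ.≤ j)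
                    (2j≤N : j ℕ.+ j ℕ.≤ T ℕ.* suc m) where

    t n : ℕ
    t = suc T
    n = suc m

    f L M : ℤ → ℤ
    f = layer t m
    L = layer t n
    M = moment t f

    N J K Δ D : ℤ
    N = + (T ℕ.* n)
    J = + j
    K = N - J + 1ℤ
    Δ = L J - L (J - 1ℤ)
    D = f J * L (J - 1ℤ) - f (J - + t) * L J

    N≡T+Tm : N ≡ + T + + (T ℕ.* m)
    N≡T+Tm = cong +_ (ℕ.*-suc T m)

    N≡T*n : N ≡ + T * + n
    N≡T*n = ℤ.pos-* T n

    private
      sum-K : ∀ N J → N - J + 1ℤ + (J - 1ℤ) ≡ N
      sum-K = solve-∀
      sum-K-1 : ∀ N J → N - J + 1ℤ - 1ℤ + J ≡ N
      sum-K-1 = solve-∀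
      sum-K-t : ∀ M J T → T + M - J + 1ℤ + (J - (1ℤ + T)) ≡ M
      sum-K-t = solve-∀
      sum-K-t′ : ∀ M J T → T + M - J + 1ℤ - (1ℤ + T) + J ≡ M
      sum-K-t′ = solve-∀

    L[K]≡L[J-1] : L K ≡ L (J - 1ℤ)
    L[K]≡L[J-1] = layer-reflect T n K (J - 1ℤ) (sum-K N J)

    L[K-1]≡L[J] : L (K - 1ℤ) ≡ L J
    L[K-1]≡L[J] = layer-reflect T n (K - 1ℤ) J (sum-K-1 N J)

    f[K]≡f[J-t] : f K ≡ f (J - + t)
    f[K]≡f[J-t] = layer-reflect T m K (J - + t)
      (trans (cong (λ z → z - J + 1ℤ + (J - + t)) N≡T+Tm) (sum-K-t (+ (T ℕ.* m)) J (+ T)))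

    f[K-t]≡f[J] : f (K - + t) ≡ f J
    f[K-t]≡f[J] = layer-reflect T m (K - + t) J
      (trans (cong (λ z → z - J + 1ℤ - + t + J) N≡T+Tm) (sum-K-t′ (+ (T ℕ.* m)) J (+ T)))

    J≥0 : 0ℤ ≤ J
    J≥0 = +≤+ ℕ.z≤n

    private
      slack : 0ℤ ≤ N - (J + J)
      slack = ℤ.i≤j⇒0≤j-i (+≤+ 2j≤N)
      slack-K : ∀ N J → 1ℤ + (N - (J + J)) ≡ N - J + 1ℤ - J
      slack-K = solve-∀
      slack-N : ∀ N J → J + (N - (J + J)) ≡ N - J
      slack-N = solve-∀
      recover : ∀ J K → J + (K - J) ≡ K
      recover = solve-∀

    K-J≥1 : 1ℤ ≤ K - J
    K-J≥1 = ≤-gap (N - (J + J)) slack (slack-K N J)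

    N-J≥1 : 1ℤ ≤ N - J
    N-J≥1 = ℤ.≤-trans (+≤+ j≥1) (≤-gap (N - (J + J)) slack (slack-N N J))

    N≥1 : 1ℤ ≤ N
    N≥1 = ℤ.≤-trans N-J≥1 (ℤ.i-j≤i N J)

    J≤K : J ≤ K
    J≤K = ≤-gap (K - J) (ℤ.≤-trans (+≤+ ℕ.z≤n) K-J≥1) (recover J K)

    K≥0 : 0ℤ ≤ K
    K≥0 = ℤ.≤-trans J≥0 J≤K

    fJ≥0 : 0ℤ ≤ f J
    fJ≥0 = layer-nonNeg t m J

    cross : K * (f J * L K) - J * (f K * L J) ≤ N * (f J * L K - f K * L J)
    cross = begin
      K * (f J * L K) - J * (f K * L J)
        ≡⟨ swap K J (f J) (L K) (f K) (L J) ⟩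
      f J * (K * L K) - f K * (J * L J)
        ≡⟨ cong₂ (λ u v → f J * u - f K * v) (layer-mean t m K) (layer-mean t m J) ⟩
      f J * (+ n * M K) - f K * (+ n * M J)
        ≡⟨ factor (+ n) (f J) (M K) (f K) (M J) ⟩
      + n * (f J * M K - f K * M J)
        ≤⟨ ℤ.*-monoˡ-≤-nonNeg (+ n) (PF₂-moment-window T f (layer-PF₂ t m) J≤K) ⟩
      + n * (+ T * (f J * L K - f K * L J))
        ≡⟨ reassoc (+ n) (+ T) (f J * L K - f K * L J) ⟩
      + T * + n * (f J * L K - f K * L J)
        ≡⟨ cong (_* (f J * L K - f K * L J)) N≡T*n ⟨
      N * (f J * L K - f K * L J)
        ∎
      where
      open ℤ.≤-Reasoning
      swap : ∀ K J a b c d → K * (a * b) - J * (c * d) ≡ a * (K * b) - c * (J * d)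
      swap = solve-∀
      factor : ∀ n a b c d → a * (n * b) - c * (n * d) ≡ n * (a * b - c * d)
      factor = solve-∀
      reassoc : ∀ n T x → n * (T * x) ≡ T * n * x
      reassoc = solve-∀

    fJ*L[J-1]≤ND : f J * L (J - 1ℤ) ≤ N * D
    fJ*L[J-1]≤ND = subst₂ (λ u v → f J * u ≤ N * (f J * u - v * L J)) L[K]≡L[J-1] f[K]≡f[J-t]
      (cross-bound N J K (f J * L K) (f K * L J) J≥0 K-J≥1 N-J≥1 (*-nonNeg fJ≥0 (layer-nonNeg t n K)) cross)

    D≥0 : 0ℤ ≤ D
    D≥0 = nonNeg-cancelˡ N≥1 (ℤ.≤-trans (*-nonNeg fJ≥0 (layer-nonNeg t n (J - 1ℤ))) fJ*L[J-1]≤ND)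

    D≡Δ*[LJ-fJ] : D ≡ Δ * (L J - f J)
    D≡Δ*[LJ-fJ] = difference-factor (L J) (L (J - 1ℤ)) (f J) (f (J - + t)) (window-difference t f J)

    j≤Tm : j ℕ.≤ T ℕ.* m
    j≤Tm = ℕ.*-cancelˡ-≤ 2 (begin
      2 ℕ.* j              ≡⟨ double j ⟩
      j ℕ.+ j              ≤⟨ 2j≤N ⟩
      T ℕ.* n              ≡⟨ ℕ.*-suc T m ⟩
      T ℕ.+ T ℕ.* m        ≤⟨ ℕ.+-monoˡ-≤ (T ℕ.* m) (ℕ.m≤m*n T m ⦃ ℕ.>-nonZero m≥1 ⦄) ⟩
      T ℕ.* m ℕ.+ T ℕ.* m  ≡⟨ double (T ℕ.* m) ⟨
      2 ℕ.* (T ℕ.* m)      ∎)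
      where
      open ℕ.≤-Reasoning
      m≥1 : 1 ℕ.≤ m
      m≥1 = ℕ.≤-trans T≥1 (ℕ.s≤s⁻¹ t≤n)
      double : ∀ x → 2 ℕ.* x ≡ x ℕ.+ x
      double x = cong (x ℕ.+_) (ℕ.+-identityʳ x)

    LJ-fJ≥1 : 1ℤ ≤ L J - f J
    LJ-fJ≥1 = begin
      1ℤ                               ≤⟨ layer-positive T m (j ℕ.∸ 1) (ℕ.≤-trans (ℕ.m∸n≤m j 1) j≤Tm) ⟩
      f (+ (j ℕ.∸ 1))                  ≡⟨ cong f (trans (ℤ.+-identityʳ (J - 1ℤ)) (+-∸ j≥1)) ⟨
      f (J - 1ℤ - + 0)                 ≤⟨ window-≥-term T (layer-nonNeg t m) (J - 1ℤ) T≥1 ⟩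
      window T f (J - 1ℤ)              ≡⟨ cancel (f J) (window T f (J - 1ℤ)) ⟨
      f J + window T f (J - 1ℤ) - f J  ≡⟨ cong (_- f J) (window-suc T f J) ⟨
      L J - f J                        ∎
      where
      open ℤ.≤-Reasoning
      cancel : ∀ a w → a + w - a ≡ w
      cancel = solve-∀

    Δ≥0 : 0ℤ ≤ Δ
    Δ≥0 = nonNeg-cancelˡ LJ-fJ≥1 (subst (0ℤ ≤_) (trans D≡Δ*[LJ-fJ] (ℤ.*-comm Δ (L J - f J))) D≥0)

    D≤Δ*LJ : D ≤ Δ * L J
    D≤Δ*LJ = ≤-gap (Δ * f J) (*-nonNeg Δ≥0 fJ≥0) (trans (cong (_+ Δ * f J) D≡Δ*[LJ-fJ]) (distrib Δ (L J) (f J)))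
      where
      distrib : ∀ d l φ → d * (l - φ) + d * φ ≡ d * l
      distrib = solve-∀

    mean-identity : + n * + t * f J ≡ (+ n - 1ℤ) * L J + K * Δ
    mean-identity = mean-balance (+ n) (+ t) K (L (J - 1ℤ)) (L J) (f J) (M K) (M (K - 1ℤ))
      (subst (λ u → K * u ≡ + n * M K) L[K]≡L[J-1] (layer-mean t m K))
      (subst (λ u → (K - 1ℤ) * u ≡ + n * M (K - 1ℤ)) L[K-1]≡L[J] (layer-mean t m (K - 1ℤ)))
      (subst₂ (λ u v → M K + + t * u ≡ M (K - 1ℤ) + v) f[K-t]≡f[J] L[K-1]≡L[J] (moment-difference t f K))

    N≤t[n-1] : N ≤ + t * (+ n - 1ℤ)
    N≤t[n-1] = ≤-gap (+ n - + t) (ℤ.i≤j⇒0≤j-i (+≤+ t≤n)) (trans (cong (_+ (+ n - + t)) N≡T*n) (expand (+ T) (+ n)))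
      where
      expand : ∀ T n → T * n + (n - (1ℤ + T)) ≡ (1ℤ + T) * (n - 1ℤ)
      expand = solve-∀

    ratio : L (J - 1ℤ) * (+ t * + t * + n + 1ℤ) ≤ L J * (+ t * + t * + n)
    ratio = ratio-bound (L (J - 1ℤ)) (L J) (f J) N (+ n) (+ t)
      (layer-nonNeg t n (J - 1ℤ)) (ℤ.≤-trans LJ-fJ≥1 (ℤ.i-j≤i (L J) (f J) ⦃ ℤ.nonNegative fJ≥0 ⦄))
      N≥1 (+≤+ ℕ.z≤n) (+≤+ ℕ.z≤n) N≤t[n-1]
      (ℤ.≤-trans fJ*L[J-1]≤ND (ℤ.*-monoˡ-≤-nonNeg N D≤Δ*LJ))
      (≤-gap (K * Δ) (*-nonNeg K≥0 Δ≥0) (sym mean-identity))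

  ℓ-ratio : ∀ t n j → 2 ℕ.≤ t → t ℕ.≤ n → 1 ℕ.≤ j → j ℕ.≤ ((t ℕ.∸ 1) ℕ.* n) ℕ./ 2 →
            + ℓ (j ℕ.∸ 1) t n * (+ (t ℕ.* t ℕ.* n) + 1ℤ) ≤ + ℓ j t n * + (t ℕ.* t ℕ.* n)
  ℓ-ratio t@(suc T) n@(suc m) j (ℕ.s≤s T≥1) t≤n@(ℕ.s≤s _) j≥1 j≤N/2 =
    subst₂ _≤_ (cong₂ (λ u v → u * (v + 1ℤ)) ℓ[j-1]≡ P≡) (cong₂ _*_ (sym (ℓ≡layer j t n)) P≡)
      (RatioBound.ratio T m j T≥1 t≤n j≥1 2j≤N)
    where
    2j≤N : j ℕ.+ j ℕ.≤ T ℕ.* n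
    2j≤N = ℕ.≤-trans (ℕ.≤-reflexive (trans (cong (j ℕ.+_) (sym (ℕ.+-identityʳ j))) (ℕ.*-comm 2 j)))
             (ℕ.≤-trans (ℕ.*-monoˡ-≤ 2 j≤N/2) (ℕ.m/n*n≤m (T ℕ.* n) 2))
    ℓ[j-1]≡ : layer t n (+ j - 1ℤ) ≡ + ℓ (j ℕ.∸ 1) t n
    ℓ[j-1]≡ = trans (cong (layer t n) (+-∸ j≥1)) (sym (ℓ≡layer (j ℕ.∸ 1) t n))
    P≡ : + t * + t * + n ≡ + (t ℕ.* t ℕ.* n)
    P≡ = sym (trans (ℤ.pos-* (t ℕ.* t) n) (cong (_* + n) (ℤ.pos-* t t)))

  /1≡mkℚ : ∀ a → + a ℚ./ 1 ≡ mkℚ (+ a) 0 (Coprimality.sym (Coprimality.1-coprimeTo a))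
  /1≡mkℚ a = ℚ.normalize-coprime (Coprimality.sym (Coprimality.1-coprimeTo a))

  /1-ratio-≤ : ∀ a b p → + a * (+ p + 1ℤ) ≤ + b * + p →
               (+ a ℚ./ 1) ℚ.* ((+ p ℚ./ 1) ℚ.+ 1ℚ) ℚ.≤ (+ b ℚ./ 1) ℚ.* (+ p ℚ./ 1)
  /1-ratio-≤ a b p ineq rewrite /1≡mkℚ a | /1≡mkℚ b | /1≡mkℚ p =
    ℚ.toℚᵘ-cancel-≤ (ℚᵘ.≤-respʳ-≃ (ℚᵘ.≃-sym (ℚ.toℚᵘ-homo-* y q)) (ℚᵘ.≤-respˡ-≃ (ℚᵘ.≃-sym homo) cross))
    where
    x = mkℚ (+ a) 0 (Coprimality.sym (Coprimality.1-coprimeTo a))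
    y = mkℚ (+ b) 0 (Coprimality.sym (Coprimality.1-coprimeTo b))
    q = mkℚ (+ p) 0 (Coprimality.sym (Coprimality.1-coprimeTo p))
    homo : ℚ.toℚᵘ (x ℚ.* (q ℚ.+ 1ℚ)) ℚᵘ.≃ ℚ.toℚᵘ x ℚᵘ.* (ℚ.toℚᵘ q ℚᵘ.+ ℚ.toℚᵘ 1ℚ)
    homo = ℚᵘ.≃-trans (ℚ.toℚᵘ-homo-* x (q ℚ.+ 1ℚ)) (ℚᵘ.*-congˡ {ℚ.toℚᵘ x} (ℚ.toℚᵘ-homo-+ q 1ℚ))
    unitˡ : ∀ a p → a * (p * 1ℤ + 1ℤ * 1ℤ) * 1ℤ ≡ a * (p + 1ℤ)
    unitˡ = solve-∀
    unitʳ : ∀ b p → b * p ≡ b * p * 1ℤ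
    unitʳ = solve-∀
    cross : ℚ.toℚᵘ x ℚᵘ.* (ℚ.toℚᵘ q ℚᵘ.+ ℚ.toℚᵘ 1ℚ) ℚᵘ.≤ ℚ.toℚᵘ y ℚᵘ.* ℚ.toℚᵘ q
    cross = ℚᵘ.*≤* (subst₂ _≤_ (sym (unitˡ (+ a) (+ p))) (unitʳ (+ b) (+ p)) ineq)

open import Data.Nat using (ℕ; _≤_; _∸_; _*_; _/_)
open import Data.Rational using (ℚ; 0ℚ; _<_; _+_) renaming (_≤_ to _≤ℚ_; _*_ to _*ℚ_)
open import Data.Rational using () renaming (_/_ to _÷ℕ_)
open import Data.Product using (Σ; _×_; _,_)
open import Data.Integer using (+_)
import Data.Nat as ℕ
import Data.Nat.Properties as ℕ
import Data.Rational as ℚ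
import Data.Integer as ℤ
open CubeLayers using (ℓ-ratio; /1-ratio-≤)

lemma3p5 : Σ ℚ λ c → (0ℚ < c) × ((t : ℕ) → 2 ≤ t → Σ ℕ λ nt → (1 ≤ nt) × ((n : ℕ) → nt ≤ n → (j : ℕ) → 1 ≤ j → j ≤ ((t ∸ 1) * n) / 2 → ((+ (ℓ (j ∸ 1) t n) ÷ℕ 1) *ℚ ((+ (t * t * n) ÷ℕ 1) + c)) ≤ℚ ((+ (ℓ j t n) ÷ℕ 1) *ℚ (+ (t * t * n) ÷ℕ 1))))
lemma3p5 = ℚ.1ℚ , ℚ.*<* (ℤ.+<+ (ℕ.s≤s ℕ.z≤n)) , λ t t≥2 → t , ℕ.<⇒≤ t≥2 , λ n t≤n j j≥1 j≤N/2 →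
  /1-ratio-≤ (ℓ (j ∸ 1) t n) (ℓ j t n) (t * t * n) (ℓ-ratio t n j t≥2 t≤n j≥1 j≤N/2)
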